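{- Let $G=(V,E)$ be a finite connected undirected simple graph with $V=\{1,\dots,N\}$. Let $\{\xi_i\}_{i\in V}$ be nonzero complex numbers with $\xi_i+\xi_i^{ -1}\neq 0$ for all $i$, and let $\{\beta_{ij}\}_{ij\in E}$ be complex numbers (equivalently, treat all of them as free variables and read the identity as an identity of rational functions). Then \[ \sum_{x_1,\ldots,x_N=\pm 1}\ \prod_{ij \in E}\bigl(1+x_{i}x_{j}\beta_{ij}\xi_{i}^{ -x_i}\xi_{j}^{ -x_j}\bigr)\prod_{i \in V}\frac{\xi_{i}^{x_i}}{\xi_{i}+\xi_{i}^{ -1}} =\sum_{s \subset E}\ \prod_{ij \in s} \beta_{ij}\prod_{i \in V} f_{d_i(s)}(\xi_{i}-\xi_{i}^{ -1}), \] where the sum on the right runs over all subsets $s$ of $E$ (including $s=\emptyset$) and $d_i(s)$ is the number of edges of $s$ incident to $i$.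
   Context: The polynomials $f_n(x)$, $n\ge 0$, are defined by $f_0(x)=1$, $f_1(x)=0$ and $f_{n+1}(x)=x f_n(x)+f_{n-1}(x)$ for $n\ge 1$. Edges $ij\in E$ are unordered pairs of distinct nodes. -}

module Defs where

open import Level using (Level)
open import Data.Nat using (ℕ; zero; suc)
open import Data.Bool using (Bool; true; false; if_then_else_)
open import Data.Fin using (Fin; _<?_)
open import Data.Fin.Properties using (_≟_)
open import Data.List using (List; []; _∷_; map; concatMap; filter; foldr; length; allFin)
open import Data.Product using (_×_; _,_; proj₁; proj₂)
open import Relation.Nullary using (¬_)
open import Relation.Nullary.Decidable using (_⊎-dec_; does)
open import Relation.Binary.PropositionalEquality using (_≡_)
open import Algebra.Bundles using (CommutativeRing)

record SimpleGraph (N : ℕ) : Set where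
  field
    adj   : Fin N → Fin N → Bool
    sym   : ∀ i j → adj i j ≡ adj j i
    irrefl : ∀ i → adj i i ≡ false

data Reach {N : ℕ} (G : SimpleGraph N) : Fin N → Fin N → Set where
  here : ∀ {i} → Reach G i i
  step : ∀ {i k j} → SimpleGraph.adj G i k ≡ true → Reach G k j → Reach G i j

Connected : ∀ {N} → SimpleGraph N → Set
Connected G = ∀ i j → Reach G i j

-- The edge set E: each unordered edge {i,j} listed once, as (i , j) with i < j.
edges : ∀ {N} → SimpleGraph N → List (Fin N × Fin N)
edges {N} G =
  concatMap (λ i → concatMap (λ j →
      if does (i <? j) then (if SimpleGraph.adj G i j then (i , j) ∷ [] else [])
      else []) (allFin N)) (allFin N)

-- all subsets of a list (as sublists); for a duplicate-free list these
-- are exactly its subsets, each listed once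
subsets : ∀ {a} {A : Set a} → List A → List (List A)
subsets [] = [] ∷ []
subsets (x ∷ xs) = let r = subsets xs in Data.List._++_ r (map (x ∷_) r)

-- all sign assignments x : Fin N → {±1}; true encodes +1, false encodes -1
assignments : (N : ℕ) → List (Fin N → Bool)
assignments zero = (λ ()) ∷ []
assignments (suc N) =
  concatMap (λ f → ((λ { Fin.zero → true ; (Fin.suc k) → f k }))
                 ∷ ((λ { Fin.zero → false ; (Fin.suc k) → f k })) ∷ [])
            (assignments N)

degIn : ∀ {N} → Fin N → List (Fin N × Fin N) → ℕ
degIn i s = length (filter (λ e → (proj₁ e ≟ i) ⊎-dec (proj₂ e ≟ i)) s)

module _ {c ℓ : Level} (R : CommutativeRing c ℓ) where
  open CommutativeRing R

  Σ[∈_]_ : ∀ {a} {A : Set a} → List A → (A → Carrier) → Carrier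
  Σ[∈ xs ] f = foldr (λ x acc → f x + acc) 0# xs

  Π[∈_]_ : ∀ {a} {A : Set a} → List A → (A → Carrier) → Carrier
  Π[∈ xs ] f = foldr (λ x acc → f x * acc) 1# xs

  fpoly : ℕ → Carrier → Carrier
  fpoly zero x = 1#
  fpoly (suc zero) x = 0#
  fpoly (suc (suc n)) x = x * fpoly (suc n) x + fpoly n x

  sgn : Bool → Carrier
  sgn true = 1#
  sgn false = - 1#

  -- ξ^{b} for b = ±1, given ξ and its inverse ξ⁻¹
  pw : Carrier → Carrier → Bool → Carrier
  pw ξ ξ⁻¹ true = ξ
  pw ξ ξ⁻¹ false = ξ⁻¹

-- Put u = -x ξ^{-x}, so u = -ξ⁻¹ for x = +1 and u = ξ for x = -1. The edge factor is
-- 1 + β_ij u_i u_j, and expanding the product over the edges gives a sum over edge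
-- subsets s of β^s ∏_i u_i^{d_i(s)}. For fixed s the sum over x then factorises over the
-- vertices, and vertex i contributes ((-ξ⁻¹)^d ξ + ξ^d ξ⁻¹) / (ξ + ξ⁻¹) with d = d_i(s).
-- Since -ξ⁻¹ and ξ are the roots of t² = (ξ - ξ⁻¹) t + 1, this Binet-type combination
-- satisfies the recurrence of f and has its initial values 1, 0, so it is f_d(ξ - ξ⁻¹).
module Submission where

open import Defs
open import Level using (Level)
open import Data.Nat using (ℕ; zero; suc)
open import Data.Bool using (Bool; true; false; not; if_then_else_; _∨_)
open import Data.Fin using (Fin; zero; suc; _<_; _<?_)
open import Data.Fin.Properties using (_≟_; <⇒≢)
open import Data.List using (List; []; _∷_; _++_; map; concatMap; tabulate; allFin)
open import Data.List.Relation.Unary.All using (All; []; _∷_; universal)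
import Data.List.Relation.Unary.All as All
open import Data.List.Relation.Unary.All.Properties using (++⁺; map⁺; concat⁺)
open import Data.Product using (_×_; _,_; proj₁; proj₂)
open import Relation.Nullary using (Dec; yes; no)
open import Relation.Nullary.Decidable using (_⊎-dec_; does)
open import Relation.Binary.PropositionalEquality using (_≡_; _≢_)
import Relation.Binary.PropositionalEquality as ≡
open import Algebra.Bundles using (CommutativeRing; Semiring)
open import Function using (_∘_; id)

Loopless : ∀ {N} → List (Fin N × Fin N) → Set
Loopless = All (λ e → proj₁ e ≢ proj₂ e)

All-subsets : ∀ {a p} {A : Set a} {P : A → Set p} {xs : List A} →
  All P xs → All (All P) (subsets xs)
All-subsets [] = [] ∷ []
All-subsets (px ∷ pxs) = ++⁺ (All-subsets pxs) (map⁺ (All.map (px ∷_) (All-subsets pxs)))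

edges-loopless : ∀ {N} (G : SimpleGraph N) → Loopless (edges G)
edges-loopless {N} G =
  concat⁺ (map⁺ (universal (λ i →
    concat⁺ (map⁺ (universal (λ j → candidate-loopless (i <? j)) (allFin N)))) (allFin N)))
  where
  candidate-loopless : ∀ {i j} (i<?j : Dec (i < j)) →
    Loopless (if does i<?j then (if SimpleGraph.adj G i j then (i , j) ∷ [] else []) else [])
  candidate-loopless (no _) = []
  candidate-loopless {i} {j} (yes i<j) with SimpleGraph.adj G i j
  ... | true = <⇒≢ i<j ∷ []
  ... | false = []

module Expansion {c ℓ} (R : CommutativeRing c ℓ) where
  open CommutativeRing R hiding (zero)
  open import Algebra.Definitions.RawSemiring (Semiring.rawSemiring semiring) using (_^_; product)
  open import Algebra.Properties.CommutativeMonoid.Sum *-commutativeMonoid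
    using () renaming (sum-cong-≋ to product-cong; ∑-distrib-+ to product-distrib-*; sum-replicate-zero to product-1)
  open import Algebra.Properties.CommutativeSemigroup +-commutativeSemigroup
    using () renaming (interchange to +-interchange)
  open import Algebra.Properties.CommutativeSemigroup *-commutativeSemigroup
    using () renaming (interchange to *-interchange; x∙yz≈y∙xz to x*yz≈y*xz)
  open import Algebra.Properties.Ring ring using (-1*x≈-x; -‿distribˡ-*; -‿distribʳ-*; -‿involutive)
  open import Algebra.Solver.Ring.NaturalCoefficients.Default commutativeSemiring
  open import Relation.Binary.Reasoning.Setoid setoid

  ∑ ∏ : ∀ {a} {A : Set a} → List A → (A → Carrier) → Carrier
  ∑ = Σ[∈_]_ R
  ∏ = Π[∈_]_ R

  private variable
    a b : Level
    A : Set a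
    B : Set b

  ∑-cong : ∀ (xs : List A) {f g} → (∀ x → f x ≈ g x) → ∑ xs f ≈ ∑ xs g
  ∑-cong [] f≈g = refl
  ∑-cong (x ∷ xs) f≈g = +-cong (f≈g x) (∑-cong xs f≈g)

  ∑-cong-All : ∀ {p} {P : A → Set p} {xs : List A} {f g} →
    All P xs → (∀ {x} → P x → f x ≈ g x) → ∑ xs f ≈ ∑ xs g
  ∑-cong-All [] f≈g = refl
  ∑-cong-All (px ∷ pxs) f≈g = +-cong (f≈g px) (∑-cong-All pxs f≈g)

  ∏-cong : ∀ (xs : List A) {f g} → (∀ x → f x ≈ g x) → ∏ xs f ≈ ∏ xs g
  ∏-cong [] f≈g = refl
  ∏-cong (x ∷ xs) f≈g = *-cong (f≈g x) (∏-cong xs f≈g)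

  ∑-++ : ∀ (xs ys : List A) f → ∑ (xs ++ ys) f ≈ ∑ xs f + ∑ ys f
  ∑-++ [] ys f = sym (+-identityˡ _)
  ∑-++ (x ∷ xs) ys f = trans (+-congˡ (∑-++ xs ys f)) (sym (+-assoc _ _ _))

  ∑-map : ∀ (h : B → A) (xs : List B) f → ∑ (map h xs) f ≡ ∑ xs (f ∘ h)
  ∑-map h [] f = ≡.refl
  ∑-map h (x ∷ xs) f = ≡.cong (f (h x) +_) (∑-map h xs f)

  *-distribˡ-∑ : ∀ k (xs : List A) f → k * ∑ xs f ≈ ∑ xs (λ x → k * f x)
  *-distribˡ-∑ k [] f = zeroʳ k
  *-distribˡ-∑ k (x ∷ xs) f = trans (distribˡ k _ _) (+-congˡ (*-distribˡ-∑ k xs f))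

  *-distribʳ-∑ : ∀ k (xs : List A) f → ∑ xs f * k ≈ ∑ xs (λ x → f x * k)
  *-distribʳ-∑ k [] f = zeroˡ k
  *-distribʳ-∑ k (x ∷ xs) f = trans (distribʳ k _ _) (+-congˡ (*-distribʳ-∑ k xs f))

  ∑-distrib-+ : ∀ (xs : List A) f g → ∑ xs (λ x → f x + g x) ≈ ∑ xs f + ∑ xs g
  ∑-distrib-+ [] f g = sym (+-identityˡ _)
  ∑-distrib-+ (x ∷ xs) f g = trans (+-congˡ (∑-distrib-+ xs f g)) (+-interchange _ _ _ _)

  ∏-distrib-* : ∀ (xs : List A) f g → ∏ xs (λ x → f x * g x) ≈ ∏ xs f * ∏ xs g
  ∏-distrib-* [] f g = sym (*-identityˡ _)
  ∏-distrib-* (x ∷ xs) f g = trans (*-congˡ (∏-distrib-* xs f g)) (*-interchange _ _ _ _)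

  ∑-zero : ∀ (xs : List A) → ∑ xs (λ _ → 0#) ≈ 0#
  ∑-zero [] = refl
  ∑-zero (x ∷ xs) = trans (+-identityˡ _) (∑-zero xs)

  ∑-comm : ∀ (xs : List A) (ys : List B) (F : A → B → Carrier) →
    ∑ xs (λ x → ∑ ys (F x)) ≈ ∑ ys (λ y → ∑ xs (λ x → F x y))
  ∑-comm [] ys F = sym (∑-zero ys)
  ∑-comm (x ∷ xs) ys F = trans (+-congˡ (∑-comm xs ys F)) (sym (∑-distrib-+ ys (F x) _))

  ∑-concatMap : ∀ (g : B → List A) (xs : List B) f →
    ∑ (concatMap g xs) f ≈ ∑ xs (λ x → ∑ (g x) f)
  ∑-concatMap g [] f = refl
  ∑-concatMap g (x ∷ xs) f = trans (∑-++ (g x) _ f) (+-congˡ (∑-concatMap g xs f))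

  ∏-1+≈∑-subsets : ∀ (xs : List A) (t : A → Carrier) →
    ∏ xs (λ x → 1# + t x) ≈ ∑ (subsets xs) (λ s → ∏ s t)
  ∏-1+≈∑-subsets [] t = sym (+-identityʳ _)
  ∏-1+≈∑-subsets (x ∷ xs) t = begin
    (1# + t x) * ∏ xs (λ x → 1# + t x)   ≈⟨ *-congˡ (∏-1+≈∑-subsets xs t) ⟩
    (1# + t x) * ∑ ss T                  ≈⟨ distribʳ _ _ _ ⟩
    1# * ∑ ss T + t x * ∑ ss T           ≈⟨ +-cong (*-identityˡ _) (*-distribˡ-∑ (t x) ss T) ⟩
    ∑ ss T + ∑ ss (λ s → T (x ∷ s))      ≡⟨ ≡.cong (∑ ss T +_) (∑-map (x ∷_) ss T) ⟨
    ∑ ss T + ∑ (map (x ∷_) ss) T         ≈⟨ ∑-++ ss _ T ⟨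
    ∑ (ss ++ map (x ∷_) ss) T            ∎
    where
    ss = subsets xs
    T = λ s → ∏ s t

  ∏-tabulate : ∀ n (g : Fin n → B) (f : B → Carrier) →
    ∏ (tabulate g) f ≡ product (f ∘ g)
  ∏-tabulate zero g f = ≡.refl
  ∏-tabulate (suc n) g f = ≡.cong (f (g zero) *_) (∏-tabulate n (g ∘ suc) f)

  ∏-allFin : ∀ n (f : Fin n → Carrier) → ∏ (allFin n) f ≡ product f
  ∏-allFin n = ∏-tabulate n id

  ∑-assignments-product : ∀ N (h : Fin N → Bool → Carrier) →
    ∑ (assignments N) (λ x → product (λ k → h k (x k))) ≈ product (λ k → h k true + h k false)
  ∑-assignments-product zero h = +-identityʳ _
  ∑-assignments-product (suc N) h = begin
    ∑ (assignments (suc N)) (λ x → product (λ k → h k (x k)))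
      ≈⟨ ∑-concatMap _ (assignments N) _ ⟩
    ∑ (assignments N) (λ x → h zero true * Q x + (h zero false * Q x + 0#))
      ≈⟨ ∑-cong (assignments N) (λ x → trans (+-congˡ (+-identityʳ _)) (sym (distribʳ (Q x) _ _))) ⟩
    ∑ (assignments N) (λ x → (h zero true + h zero false) * Q x)
      ≈⟨ *-distribˡ-∑ _ (assignments N) Q ⟨
    (h zero true + h zero false) * ∑ (assignments N) Q
      ≈⟨ *-congˡ (∑-assignments-product N (h ∘ suc)) ⟩
    (h zero true + h zero false) * product (λ k → h (suc k) true + h (suc k) false) ∎
    where
    Q : (Fin N → Bool) → Carrier
    Q x = product (λ k → h (suc k) (x k))

  incident : ∀ {N} → Fin N × Fin N → Fin N → Bool
  incident (i , j) k = does ((i ≟ k) ⊎-dec (j ≟ k))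

  product-select : ∀ n (a : Fin n → Carrier) j → product (λ k → if does (j ≟ k) then a k else 1#) ≈ a j
  product-select (suc n) a zero = trans (*-congˡ (product-1 n)) (*-identityʳ _)
  product-select (suc n) a (suc j) = trans (*-identityˡ _) (product-select n (a ∘ suc) j)

  product-incident : ∀ n (a : Fin n → Carrier) {i j} → i ≢ j →
    product (λ k → if incident (i , j) k then a k else 1#) ≈ a i * a j
  product-incident (suc n) a {zero} {zero} i≢j with () ← i≢j ≡.refl
  product-incident (suc n) a {zero} {suc j} _ = *-congˡ (product-select n (a ∘ suc) j)
  product-incident (suc n) a {suc i} {zero} _ =
    trans (*-congˡ (trans (product-cong (λ k → if-∨false (does (i ≟ k)))) (product-select n (a ∘ suc) i)))
          (*-comm _ _)
    where
    if-∨false : ∀ b {x} → (if b ∨ false then x else 1#) ≈ (if b then x else 1#)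
    if-∨false true = refl
    if-∨false false = refl
  product-incident (suc n) a {suc i} {suc j} i≢j =
    trans (*-identityˡ _) (product-incident n (a ∘ suc) (i≢j ∘ ≡.cong suc))

  ^-degIn-∷ : ∀ {N} x (e : Fin N × Fin N) s k →
    x ^ degIn k (e ∷ s) ≈ (if incident e k then x else 1#) * x ^ degIn k s
  ^-degIn-∷ x (i , j) s k with i ≟ k | j ≟ k
  ... | yes _ | _ = refl
  ... | no _ | yes _ = refl
  ... | no _ | no _ = sym (*-identityˡ _)

  ∏-endpoints≈product-^-degIn : ∀ {N} (a : Fin N → Carrier) (s : List (Fin N × Fin N)) →
    Loopless s → ∏ s (λ e → a (proj₁ e) * a (proj₂ e)) ≈ product (λ k → a k ^ degIn k s)
  ∏-endpoints≈product-^-degIn {N} a [] [] = sym (product-1 N)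
  ∏-endpoints≈product-^-degIn {N} a (e@(i , j) ∷ s) (i≢j ∷ loopless) = begin
    a i * a j * ∏ s (λ e → a (proj₁ e) * a (proj₂ e))
      ≈⟨ *-cong (sym (product-incident N a i≢j)) (∏-endpoints≈product-^-degIn a s loopless) ⟩
    product (λ k → if incident e k then a k else 1#) * product (λ k → a k ^ degIn k s)
      ≈⟨ product-distrib-* {N} _ _ ⟨
    product (λ k → (if incident e k then a k else 1#) * a k ^ degIn k s)
      ≈⟨ product-cong (λ k → ^-degIn-∷ (a k) e s k) ⟨
    product (λ k → a k ^ degIn k (e ∷ s)) ∎

  ^-recurrence : ∀ {y a} → a * a ≈ y * a + 1# → ∀ d → a ^ suc (suc d) ≈ y * a ^ suc d + a ^ d
  ^-recurrence {y} {a} a²≈ya+1 d = begin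
    a * (a * a ^ d)              ≈⟨ *-assoc a a _ ⟨
    a * a * a ^ d                ≈⟨ *-congʳ a²≈ya+1 ⟩
    (y * a + 1#) * a ^ d         ≈⟨ distribʳ _ _ _ ⟩
    y * a * a ^ d + 1# * a ^ d   ≈⟨ +-cong (*-assoc y a _) (*-identityˡ _) ⟩
    y * (a * a ^ d) + a ^ d      ∎

  -- By Vieta, the first two hypotheses say that a and b are the roots of t² = y t + 1.
  fpoly-binet : ∀ {y a b p q} → a + b ≈ y → a * b + 1# ≈ 0# → p + q ≈ 1# → a * p + b * q ≈ 0# →
    ∀ d → a ^ d * p + b ^ d * q ≈ fpoly R d y
  fpoly-binet _ _ p+q≈1 _ zero = trans (+-cong (*-identityˡ _) (*-identityˡ _)) p+q≈1
  fpoly-binet _ _ _ ap+bq≈0 (suc zero) =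
    trans (+-cong (*-congʳ (*-identityʳ _)) (*-congʳ (*-identityʳ _))) ap+bq≈0
  fpoly-binet {y} {a} {b} {p} {q} a+b≈y ab+1≈0 p+q≈1 ap+bq≈0 (suc (suc d)) = begin
    a ^ (suc (suc d)) * p + b ^ (suc (suc d)) * q
      ≈⟨ +-cong (*-congʳ (^-recurrence a²≈ya+1 d)) (*-congʳ (^-recurrence b²≈yb+1 d)) ⟩
    (y * a ^ (suc d) + a ^ d) * p + (y * b ^ (suc d) + b ^ d) * q
      ≈⟨ solve 7 (λ y a₁ a₀ p b₁ b₀ q →
                   (y :* a₁ :+ a₀) :* p :+ (y :* b₁ :+ b₀) :* q
                := y :* (a₁ :* p :+ b₁ :* q) :+ (a₀ :* p :+ b₀ :* q))
                refl y (a ^ (suc d)) (a ^ d) p (b ^ (suc d)) (b ^ d) q ⟩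
    y * (a ^ (suc d) * p + b ^ (suc d) * q) + (a ^ d * p + b ^ d * q)
      ≈⟨ +-cong (*-congˡ (binet (suc d))) (binet d) ⟩
    y * fpoly R (suc d) y + fpoly R d y ∎
    where
    binet = fpoly-binet a+b≈y ab+1≈0 p+q≈1 ap+bq≈0
    root-equation : ∀ {u v} → u + v ≈ y → v * u + 1# ≈ 0# → u * u ≈ y * u + 1#
    root-equation {u} {v} u+v≈y vu+1≈0 = sym (begin
      y * u + 1#              ≈⟨ +-congʳ (*-congʳ u+v≈y) ⟨
      (u + v) * u + 1#        ≈⟨ trans (+-congʳ (distribʳ u u v)) (+-assoc _ _ _) ⟩
      u * u + (v * u + 1#)    ≈⟨ +-congˡ vu+1≈0 ⟩
      u * u + 0#              ≈⟨ +-identityʳ _ ⟩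
      u * u                   ∎)
    a²≈ya+1 = root-equation a+b≈y (trans (+-congʳ (*-comm b a)) ab+1≈0)
    b²≈yb+1 = root-equation (trans (+-comm b a) a+b≈y) ab+1≈0

  -- The weight u = -x ξ^{-x} of the sign x; its two values are the roots of t² = (ξ - ξ⁻¹) t + 1.
  root : Carrier → Carrier → Bool → Carrier
  root ξ ξ⁻¹ true = - ξ⁻¹
  root ξ ξ⁻¹ false = ξ

  vertexSum≈fpoly : ∀ {ξ ξ⁻¹ δ} → ξ * ξ⁻¹ ≈ 1# → (ξ + ξ⁻¹) * δ ≈ 1# → ∀ d →
    root ξ ξ⁻¹ true ^ d * (pw R ξ ξ⁻¹ true * δ) + root ξ ξ⁻¹ false ^ d * (pw R ξ ξ⁻¹ false * δ)
      ≈ fpoly R d (ξ - ξ⁻¹)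
  vertexSum≈fpoly {ξ} {ξ⁻¹} {δ} ξξ⁻¹≈1 [ξ+ξ⁻¹]δ≈1 =
    fpoly-binet (+-comm _ _) -ξ⁻¹ξ+1≈0 (trans (sym (distribʳ δ ξ ξ⁻¹)) [ξ+ξ⁻¹]δ≈1) cancel
    where
    -ξ⁻¹ξ+1≈0 : - ξ⁻¹ * ξ + 1# ≈ 0#
    -ξ⁻¹ξ+1≈0 = begin
      - ξ⁻¹ * ξ + 1#          ≈⟨ +-cong (-‿distribˡ-* ξ⁻¹ ξ) ξξ⁻¹≈1 ⟨
      - (ξ⁻¹ * ξ) + ξ * ξ⁻¹   ≈⟨ +-congʳ (-‿cong (*-comm ξ⁻¹ ξ)) ⟩
      - (ξ * ξ⁻¹) + ξ * ξ⁻¹   ≈⟨ -‿inverseˡ _ ⟩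
      0#                      ∎
    cancel : - ξ⁻¹ * (ξ * δ) + ξ * (ξ⁻¹ * δ) ≈ 0#
    cancel = begin
      - ξ⁻¹ * (ξ * δ) + ξ * (ξ⁻¹ * δ)     ≈⟨ +-cong (-‿distribˡ-* ξ⁻¹ _) (x*yz≈y*xz ξ⁻¹ ξ δ) ⟨
      - (ξ⁻¹ * (ξ * δ)) + ξ⁻¹ * (ξ * δ)   ≈⟨ -‿inverseˡ _ ⟩
      0#                                  ∎

  sgn*pw-not≈-root : ∀ ξ ξ⁻¹ b → sgn R b * pw R ξ ξ⁻¹ (not b) ≈ - root ξ ξ⁻¹ b
  sgn*pw-not≈-root ξ ξ⁻¹ true = trans (*-identityˡ ξ⁻¹) (sym (-‿involutive ξ⁻¹))
  sgn*pw-not≈-root ξ ξ⁻¹ false = -1*x≈-x ξ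

  edgeFactor≈1+β*roots : ∀ b₁ b₂ ξ₁ ξ₁⁻¹ ξ₂ ξ₂⁻¹ β →
    1# + sgn R b₁ * sgn R b₂ * β * pw R ξ₁ ξ₁⁻¹ (not b₁) * pw R ξ₂ ξ₂⁻¹ (not b₂)
      ≈ 1# + β * (root ξ₁ ξ₁⁻¹ b₁ * root ξ₂ ξ₂⁻¹ b₂)
  edgeFactor≈1+β*roots b₁ b₂ ξ₁ ξ₁⁻¹ ξ₂ ξ₂⁻¹ β = +-congˡ (begin
    s₁ * s₂ * β * p₁ * p₂
      ≈⟨ solve 5 (λ s₁ s₂ β p₁ p₂ → s₁ :* s₂ :* β :* p₁ :* p₂ := β :* ((s₁ :* p₁) :* (s₂ :* p₂)))
                 refl s₁ s₂ β p₁ p₂ ⟩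
    β * ((s₁ * p₁) * (s₂ * p₂))
      ≈⟨ *-congˡ (*-cong (sgn*pw-not≈-root ξ₁ ξ₁⁻¹ b₁) (sgn*pw-not≈-root ξ₂ ξ₂⁻¹ b₂)) ⟩
    β * (- r₁ * - r₂)
      ≈⟨ *-congˡ (trans (sym (-‿distribˡ-* r₁ (- r₂)))
                 (trans (-‿cong (sym (-‿distribʳ-* r₁ r₂))) (-‿involutive _))) ⟩
    β * (r₁ * r₂) ∎)
    where
    s₁ = sgn R b₁
    s₂ = sgn R b₂
    p₁ = pw R ξ₁ ξ₁⁻¹ (not b₁)
    p₂ = pw R ξ₂ ξ₂⁻¹ (not b₂)
    r₁ = root ξ₁ ξ₁⁻¹ b₁
    r₂ = root ξ₂ ξ₂⁻¹ b₂

  ∑-assignments-subset : ∀ N (ξ ξ⁻¹ δ : Fin N → Carrier) →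
    (∀ i → ξ i * ξ⁻¹ i ≈ 1#) → (∀ i → (ξ i + ξ⁻¹ i) * δ i ≈ 1#) →
    (β : Fin N × Fin N → Carrier) (s : List (Fin N × Fin N)) → Loopless s →
    ∑ (assignments N) (λ x →
        ∏ s (λ e → β e * (root (ξ (proj₁ e)) (ξ⁻¹ (proj₁ e)) (x (proj₁ e))
                        * root (ξ (proj₂ e)) (ξ⁻¹ (proj₂ e)) (x (proj₂ e))))
      * ∏ (allFin N) (λ i → pw R (ξ i) (ξ⁻¹ i) (x i) * δ i))
    ≈ ∏ s β * ∏ (allFin N) (λ i → fpoly R (degIn i s) (ξ i - ξ⁻¹ i))
  ∑-assignments-subset N ξ ξ⁻¹ δ ξξ⁻¹≈1 [ξ+ξ⁻¹]δ≈1 β s loopless = begin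
    ∑ (assignments N) (λ x → ∏ s (λ e → β e * (r x (proj₁ e) * r x (proj₂ e))) * W x)
      ≈⟨ ∑-cong (assignments N) summand ⟩
    ∑ (assignments N) (λ x → ∏ s β * product (λ k → h k (x k)))
      ≈⟨ *-distribˡ-∑ _ (assignments N) _ ⟨
    ∏ s β * ∑ (assignments N) (λ x → product (λ k → h k (x k)))
      ≈⟨ *-congˡ (∑-assignments-product N h) ⟩
    ∏ s β * product (λ k → h k true + h k false)
      ≈⟨ *-congˡ (product-cong (λ k → vertexSum≈fpoly (ξξ⁻¹≈1 k) ([ξ+ξ⁻¹]δ≈1 k) (degIn k s))) ⟩
    ∏ s β * product (λ k → fpoly R (degIn k s) (ξ k - ξ⁻¹ k))
      ≡⟨ ≡.cong (∏ s β *_) (∏-allFin N _) ⟨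
    ∏ s β * ∏ (allFin N) (λ k → fpoly R (degIn k s) (ξ k - ξ⁻¹ k)) ∎
    where
    r : (Fin N → Bool) → Fin N → Carrier
    r x k = root (ξ k) (ξ⁻¹ k) (x k)
    W : (Fin N → Bool) → Carrier
    W x = ∏ (allFin N) (λ k → pw R (ξ k) (ξ⁻¹ k) (x k) * δ k)
    h : Fin N → Bool → Carrier
    h k b = root (ξ k) (ξ⁻¹ k) b ^ degIn k s * (pw R (ξ k) (ξ⁻¹ k) b * δ k)
    summand : ∀ x → ∏ s (λ e → β e * (r x (proj₁ e) * r x (proj₂ e))) * W x
                  ≈ ∏ s β * product (λ k → h k (x k))
    summand x = begin
      ∏ s (λ e → β e * (r x (proj₁ e) * r x (proj₂ e))) * W x
        ≈⟨ *-cong (∏-distrib-* s β _) (reflexive (∏-allFin N _)) ⟩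
      ∏ s β * ∏ s (λ e → r x (proj₁ e) * r x (proj₂ e)) * product (λ k → pw R (ξ k) (ξ⁻¹ k) (x k) * δ k)
        ≈⟨ *-assoc _ _ _ ⟩
      ∏ s β * (∏ s (λ e → r x (proj₁ e) * r x (proj₂ e)) * product (λ k → pw R (ξ k) (ξ⁻¹ k) (x k) * δ k))
        ≈⟨ *-congˡ (*-congʳ (∏-endpoints≈product-^-degIn (r x) s loopless)) ⟩
      ∏ s β * (product (λ k → r x k ^ degIn k s) * product (λ k → pw R (ξ k) (ξ⁻¹ k) (x k) * δ k))
        ≈⟨ *-congˡ (product-distrib-* {N} _ _) ⟨
      ∏ s β * product (λ k → h k (x k)) ∎

theorem1 : ∀ {c ℓ} (R : CommutativeRing c ℓ) → let open CommutativeRing R in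
    (N : ℕ) (G : SimpleGraph N) → Connected G →
    (ξ ξ⁻¹ δ : Fin N → Carrier) →
    (∀ i → ξ i * ξ⁻¹ i ≈ 1#) →
    (∀ i → (ξ i + ξ⁻¹ i) * δ i ≈ 1#) →
    (β : Fin N × Fin N → Carrier) →
    Σ[∈_]_ R (assignments N) (λ x →
        Π[∈_]_ R (edges G) (λ { (i , j) →
          1# + sgn R (x i) * sgn R (x j) * β (i , j)
               * pw R (ξ i) (ξ⁻¹ i) (not (x i)) * pw R (ξ j) (ξ⁻¹ j) (not (x j)) })
      * Π[∈_]_ R (allFin N) (λ i → pw R (ξ i) (ξ⁻¹ i) (x i) * δ i))
    ≈ Σ[∈_]_ R (subsets (edges G)) (λ s →
        Π[∈_]_ R s β
      * Π[∈_]_ R (allFin N) (λ i → fpoly R (degIn i s) (ξ i - ξ⁻¹ i)))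
theorem1 R N G _ ξ ξ⁻¹ δ ξξ⁻¹≈1 [ξ+ξ⁻¹]δ≈1 β = begin
  ∑ X (λ x → ∏ E (edgeFactor x) * W x)
    ≈⟨ ∑-cong X (λ x → *-congʳ (trans (∏-cong E (edgeFactor≈1+t x)) (∏-1+≈∑-subsets E (t x)))) ⟩
  ∑ X (λ x → ∑ (subsets E) (λ s → ∏ s (t x)) * W x)
    ≈⟨ ∑-cong X (λ x → *-distribʳ-∑ (W x) (subsets E) _) ⟩
  ∑ X (λ x → ∑ (subsets E) (λ s → ∏ s (t x) * W x))
    ≈⟨ ∑-comm X (subsets E) _ ⟩
  ∑ (subsets E) (λ s → ∑ X (λ x → ∏ s (t x) * W x))
    ≈⟨ ∑-cong-All (All-subsets (edges-loopless G))
         (∑-assignments-subset N ξ ξ⁻¹ δ ξξ⁻¹≈1 [ξ+ξ⁻¹]δ≈1 β _) ⟩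
  ∑ (subsets E) (λ s → ∏ s β * ∏ (allFin N) (λ i → fpoly R (degIn i s) (ξ i - ξ⁻¹ i))) ∎
  where
  open CommutativeRing R hiding (zero)
  open import Relation.Binary.Reasoning.Setoid setoid
  open Expansion R
  X = assignments N
  E = edges G
  edgeFactor : (Fin N → Bool) → Fin N × Fin N → Carrier
  edgeFactor x (i , j) = 1# + sgn R (x i) * sgn R (x j) * β (i , j)
                              * pw R (ξ i) (ξ⁻¹ i) (not (x i)) * pw R (ξ j) (ξ⁻¹ j) (not (x j))
  t : (Fin N → Bool) → Fin N × Fin N → Carrier
  t x (i , j) = β (i , j) * (root (ξ i) (ξ⁻¹ i) (x i) * root (ξ j) (ξ⁻¹ j) (x j))
  edgeFactor≈1+t : ∀ x e → edgeFactor x e ≈ 1# + t x e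
  edgeFactor≈1+t x (i , j) = edgeFactor≈1+β*roots (x i) (x j) (ξ i) (ξ⁻¹ i) (ξ j) (ξ⁻¹ j) (β (i , j))
  W : (Fin N → Bool) → Carrier
  W x = ∏ (allFin N) (λ i → pw R (ξ i) (ξ⁻¹ i) (x i) * δ i)
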